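{- Fix $T$ with $1<T<\tfrac43$. Let $C_0$ be a configuration on the infinite square grid $\mathbb{Z}^2$ in which the set of defectors is a single finite connected set (a $k$-cluster of defectors) and all other vertices are cooperators, and suppose this set is contained in an axis-parallel rectangle of length $\ell$ and width $w$. Then there exists an axis-parallel rectangle of length $\ell+4$ and width $w+4$ such that, in the PD process started from $C_0$, every vertex that is a defector at some time lies in this rectangle.
   Context: A configuration on $\mathbb{Z}^2$ is a map $C:\mathbb{Z}^2\to\{0,1\}$; $1$ means cooperator, $0$ means defector. The pay-off $f(a,b)$ to a player with strategy $a$ against strategy $b$ is $f(0,0)=0$, $f(0,1)=T$, $f(1,0)=0$, $f(1,1)=1$. The score of $v$ is $s(v)=\sum_{x\in N(v)} f(C(v),C(x))$. The most successful neighbours of $v$ are the vertices of $N[v]$ of maximum score (defectors taken as most successful in case of a tie between a cooperator and a defector). A vertex is weak if its strategy differs from that of its most successful neighbours; updating a vertex changes its strategy if it is currently weak and does nothing otherwise. PD process: given $C_t$, let $W_t$ be the set of weak vertices; if $W_t=\emptyset$ the process stops. Otherwise a uniformly random ordering of $W_t$ is chosen and the vertices are updated one at a time in that order, each with respect to the current configuration, producing $C_{t+1}$.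
   Formalization: The parameter $T$ ranges only over the rationals with $1<T<\tfrac43$. -}

module Defs where

open import Data.Bool using (Bool; true; false; not)
open import Data.Nat using (ℕ)
open import Data.Integer as ℤ using (ℤ; +_; -[1+_]) renaming (_+_ to _+ℤ_; _-_ to _-ℤ_; _≤_ to _≤ℤ_)
open import Data.Rational using (ℚ; 0ℚ; 1ℚ; _/_; _<_; _≤_) renaming (_+_ to _+ℚ_)
open import Data.Product using (_×_; _,_; Σ; ∃; ∃-syntax)
open import Data.Sum using (_⊎_)
open import Data.List using (List; []; _∷_; foldr; map)
open import Data.List.Membership.Propositional using (_∈_)
open import Data.List.Relation.Unary.Unique.Propositional using (Unique)
open import Relation.Binary.PropositionalEquality using (_≡_; _≢_)
open import Relation.Binary.Construct.Closure.ReflexiveTransitive using (Star)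
open import Relation.Nullary using (¬_)
open import Function.Bundles using (_⇔_)

Vertex : Set
Vertex = ℤ × ℤ

-- Strategies: false = 0 = defector, true = 1 = cooperator.
Strategy : Set
Strategy = Bool

Config : Set
Config = Vertex → Strategy

neighbours : Vertex → List Vertex
neighbours (x , y) =
  (x +ℤ + 1 , y) ∷ (x -ℤ + 1 , y) ∷ (x , y +ℤ + 1) ∷ (x , y -ℤ + 1) ∷ []

closedNbhd : Vertex → List Vertex
closedNbhd v = v ∷ neighbours v

Adjacent : Vertex → Vertex → Set
Adjacent u v = v ∈ neighbours u

payoff : ℚ → Strategy → Strategy → ℚ
payoff T false false = 0ℚ
payoff T false true  = T
payoff T true  false = 0ℚ
payoff T true  true  = 1ℚ

score : ℚ → Config → Vertex → ℚ
score T C v = foldr _+ℚ_ 0ℚ (map (λ x → payoff T (C v) (C x)) (neighbours v))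

-- Some defector in N[v] attains the maximum score over N[v]; in that case the
-- most successful neighbours of v are defectors (tie-breaking in favour of
-- defectors), otherwise they are cooperators.
DefectorMostSuccessful : ℚ → Config → Vertex → Set
DefectorMostSuccessful T C v =
  ∃[ u ] (u ∈ closedNbhd v × C u ≡ false ×
          (∀ x → x ∈ closedNbhd v → score T C x ≤ score T C u))

-- v is weak iff its strategy differs from that of its most successful neighbours.
Weak : ℚ → Config → Vertex → Set
Weak T C v =
  (C v ≡ true × DefectorMostSuccessful T C v) ⊎
  (C v ≡ false × ¬ DefectorMostSuccessful T C v)

UpdateOne : ℚ → Config → Vertex → Config → Set
UpdateOne T C v C' =
  (∀ u → u ≢ v → C' u ≡ C u) ×
  (Weak T C v → C' v ≡ not (C v)) ×
  (¬ Weak T C v → C' v ≡ C v)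

data UpdateSeq (T : ℚ) : Config → List Vertex → Config → Set where
  done : ∀ {C C'} → (∀ u → C' u ≡ C u) → UpdateSeq T C [] C'
  next : ∀ {C C₁ C' v vs} → UpdateOne T C v C₁ → UpdateSeq T C₁ vs C' →
         UpdateSeq T C (v ∷ vs) C'

-- One round of the PD process: some ordering L of the (finite) set W_t of weak
-- vertices is chosen and the vertices are updated in that order.  Every
-- ordering is allowed (each has positive probability).  If W_t = ∅ the only
-- step is the trivial one, so the configuration stays fixed (process stopped).
PDStep : ℚ → Config → Config → Set
PDStep T C C' =
  ∃[ L ] (Unique L × (∀ v → (v ∈ L ⇔ Weak T C v)) × UpdateSeq T C L C')

Reachable : ℚ → Config → Config → Set
Reachable T = Star (PDStep T)

-- Axis-parallel rectangle [x₀, x₀+ℓ] × [y₀, y₀+w] (length ℓ along the first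
-- axis, width w along the second).
InRect : ℤ → ℤ → ℕ → ℕ → Vertex → Set
InRect x₀ y₀ ℓ w (x , y) =
  (x₀ ≤ℤ x × x ≤ℤ x₀ +ℤ + ℓ) × (y₀ ≤ℤ y × y ≤ℤ y₀ +ℤ + w)

ConnectedSet : List Vertex → Set
ConnectedSet D =
  ∀ u v → u ∈ D → v ∈ D → Star (λ a b → a ∈ D × b ∈ D × Adjacent a b) u v

DefectorCluster : Config → List Vertex → Set
DefectorCluster C D = (∀ v → (C v ≡ false ⇔ v ∈ D)) × ConnectedSet D

{-# OPTIONS --safe #-}
-- While two or more defectors are present none of them is isolated (the invariant Confined below), so
-- every defector scores at most 3T < 4, whereas a cooperator whose neighbours all cooperate scores 4.
-- A cooperator outside a rectangle containing all defectors has such a vertex in its closed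
-- neighbourhood, so it cannot turn defector: the defectors never leave that rectangle. When a weak
-- defector w turns cooperator, a defecting neighbour u of w cannot become isolated: w would be its only
-- defecting neighbour, so u would score 3T > 3, more than the best vertex of N[w], which is a cooperator
-- next to the defector w and so scores at most 3. A lone defector spreads only to its neighbours,
-- which accounts for one extra unit on each side.
module Submission where

open import Defs
open import Data.Nat using (ℕ; _+_)
open import Data.Integer using (ℤ; +_)
open import Data.Rational using (ℚ; 1ℚ; _/_; _<_)
open import Data.Product using (_×_; ∃-syntax)
open import Data.List using (List)
open import Data.Bool using (false)
open import Relation.Binary.PropositionalEquality using (_≡_)

open import Algebra.Definitions.RawMonoid Data.Rational.+-0-rawMonoid using () renaming (_×_ to _·_)
open import Data.Bool using (true; not) renaming (_≟_ to _≟ᵇ_)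
open import Data.Bool.Properties using (¬-not; not-¬)
open import Data.Empty using (⊥; ⊥-elim)
open import Data.Integer using (-_; +<+; -<+; +≤+) renaming (_+_ to _+ℤ_; _-_ to _-ℤ_; _≤_ to _≤ℤ_; _<_ to _<ℤ_)
import Data.Integer.Properties as ℤ
open import Data.Integer.Tactic.RingSolver using (solve-∀)
open import Data.List using ([]; _∷_; length; filter; foldr; map)
open import Data.List.Membership.Propositional using (_∈_; find; lose)
open import Data.List.Properties using (filter-all; filter-notAll)
open import Data.List.Relation.Unary.All as All using (All; all?; []; _∷_)
open import Data.List.Relation.Unary.AllPairs using ([]; _∷_)
open import Data.List.Relation.Unary.Any as Any using (Any; here; there; any?)
open import Data.List.Relation.Unary.Unique.Propositional using (Unique)
import Data.Nat as ℕ
import Data.Nat.Properties as ℕ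
open import Data.Product using (_,_; proj₁; proj₂)
open import Data.Product.Properties using (≡-dec)
open import Data.Rational using (0ℚ; *≤*) renaming (_+_ to _+ℚ_; _≤_ to _≤ℚ_)
import Data.Rational.Properties as ℚ
open import Data.Sum using (_⊎_; inj₁; inj₂)
open import Function using (_∘_)
open import Function.Bundles using (Equivalence)
open import Relation.Binary.Bundles using (DecTotalOrder)
open import Relation.Binary.Construct.Closure.ReflexiveTransitive using (ε; _◅_)
open import Relation.Binary.Definitions using (DecidableEquality)
open import Relation.Binary.PropositionalEquality using (refl; sym; trans; cong; cong₂; subst; subst₂; _≢_; module ≡-Reasoning)
open import Relation.Nullary using (¬_; Dec; yes; no)
open import Relation.Nullary.Decidable using (_×-dec_; _⊎-dec_; ¬?; map′; decidable-stable)
open import Relation.Unary using (Decidable)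

open import Data.List.Extrema (DecTotalOrder.totalOrder ℚ.≤-decTotalOrder)
  using (argmax; argmax-sel; f[⊥]≤f[argmax]; f[xs]≤f[argmax])

_≟ᵛ_ : DecidableEquality Vertex
_≟ᵛ_ = ≡-dec ℤ._≟_ ℤ._≟_

[x+1]-1≡x : ∀ x → x +ℤ + 1 -ℤ + 1 ≡ x
[x+1]-1≡x = solve-∀

[x-1]+1≡x : ∀ x → x -ℤ + 1 +ℤ + 1 ≡ x
[x-1]+1≡x = solve-∀

adjacent-sym : ∀ u v → Adjacent u v → Adjacent v u
adjacent-sym (x , y) _ (here refl) = there (here (cong (_, y) (sym ([x+1]-1≡x x))))
adjacent-sym (x , y) _ (there (here refl)) = here (cong (_, y) (sym ([x-1]+1≡x x)))
adjacent-sym (x , y) _ (there (there (here refl))) = there (there (there (here (cong (x ,_) (sym ([x+1]-1≡x y))))))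
adjacent-sym (x , y) _ (there (there (there (here refl)))) = there (there (here (cong (x ,_) (sym ([x-1]+1≡x y)))))

length-neighbours : ∀ v → length (neighbours v) ≡ 4
length-neighbours (x , y) = refl

neighbours-unique : ∀ v → Unique (neighbours v)
neighbours-unique (x , y) =
  (first (x+1≢x-1 x) ∷ first (x+1≢x x) ∷ first (x+1≢x x) ∷ []) ∷
  (first (x-1≢x x) ∷ first (x-1≢x x) ∷ []) ∷
  (second (x+1≢x-1 y) ∷ []) ∷
  [] ∷
  []
  where
  first : ∀ {a b c d : ℤ} → a ≢ b → (a , c) ≢ (b , d)
  first a≢b = a≢b ∘ cong proj₁
  second : ∀ {a b c d : ℤ} → c ≢ d → (a , c) ≢ (b , d)
  second c≢d = c≢d ∘ cong proj₂
  x<x+1 : ∀ x → x <ℤ x +ℤ + 1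
  x<x+1 x = subst (_<ℤ x +ℤ + 1) (ℤ.+-identityʳ x) (ℤ.+-monoʳ-< x (+<+ (ℕ.s≤s ℕ.z≤n)))
  x-1<x : ∀ x → x -ℤ + 1 <ℤ x
  x-1<x x = subst (x -ℤ + 1 <ℤ_) (ℤ.+-identityʳ x) (ℤ.+-monoʳ-< x -<+)
  x+1≢x : ∀ x → x +ℤ + 1 ≢ x
  x+1≢x x = ℤ.<⇒≢ (x<x+1 x) ∘ sym
  x-1≢x : ∀ x → x -ℤ + 1 ≢ x
  x-1≢x x = ℤ.<⇒≢ (x-1<x x)
  x+1≢x-1 : ∀ x → x +ℤ + 1 ≢ x -ℤ + 1
  x+1≢x-1 x = ℤ.<⇒≢ (ℤ.<-trans (x-1<x x) (x<x+1 x)) ∘ sym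

closedNbhd-≢⇒adjacent : ∀ {u v} → u ∈ closedNbhd v → u ≢ v → Adjacent v u
closedNbhd-≢⇒adjacent (here u≡v) u≢v = ⊥-elim (u≢v u≡v)
closedNbhd-≢⇒adjacent (there u∈) _ = u∈

defector≢cooperator : ∀ {C : Config} {u v} → C u ≡ false → C v ≡ true → u ≢ v
defector≢cooperator cu cv refl = not-¬ cu cv

Interval : Set
Interval = ℤ × ℕ

infix 4 _∈ᴵ_ _∈ᴵ?_

_∈ᴵ_ : ℤ → Interval → Set
x ∈ᴵ (a , n) = a ≤ℤ x × x ≤ℤ a +ℤ + n

_∈ᴵ?_ : ∀ x I → Dec (x ∈ᴵ I)
x ∈ᴵ? (a , n) = (a ℤ.≤? x) ×-dec (x ℤ.≤? a +ℤ + n)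

expandᴵ : Interval → Interval
expandᴵ (a , n) = (a -ℤ + 1 , 2 + n)

expandᴵ-top : ∀ a n → a -ℤ + 1 +ℤ + (2 + n) ≡ a +ℤ + n +ℤ + 1
expandᴵ-top a n = identity a (+ n)
  where
  identity : ∀ a m → a -ℤ + 1 +ℤ (+ 2 +ℤ m) ≡ a +ℤ m +ℤ + 1
  identity = solve-∀

≤-expand-bottom : ∀ {x} a → a ≤ℤ x → a -ℤ + 1 ≤ℤ x
≤-expand-bottom a = ℤ.≤-trans (ℤ.i-j≤i a (+ 1))

≤-expand-top : ∀ {x} a n → x ≤ℤ a +ℤ + n → x ≤ℤ a -ℤ + 1 +ℤ + (2 + n)
≤-expand-top {x} a n x≤ = subst (x ≤ℤ_) (sym (expandᴵ-top a n)) (ℤ.≤-trans x≤ (ℤ.i≤i+j _ (+ 1)))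

∈-expandᴵ : ∀ {x} I → x ∈ᴵ I → x ∈ᴵ expandᴵ I
∈-expandᴵ (a , n) (a≤x , x≤) = ≤-expand-bottom a a≤x , ≤-expand-top a n x≤

x+1-∈-expandᴵ : ∀ {x} I → x ∈ᴵ I → x +ℤ + 1 ∈ᴵ expandᴵ I
x+1-∈-expandᴵ {x} (a , n) (a≤x , x≤) =
  ≤-expand-bottom a (ℤ.≤-trans a≤x (ℤ.i≤i+j x (+ 1))) ,
  subst (x +ℤ + 1 ≤ℤ_) (sym (expandᴵ-top a n)) (ℤ.+-monoˡ-≤ (+ 1) x≤)

x-1-∈-expandᴵ : ∀ {x} I → x ∈ᴵ I → x -ℤ + 1 ∈ᴵ expandᴵ I
x-1-∈-expandᴵ {x} (a , n) (a≤x , x≤) =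
  ℤ.+-monoˡ-≤ (- + 1) a≤x ,
  ≤-expand-top a n (ℤ.≤-trans (ℤ.i-j≤i x (+ 1)) x≤)

∉ᴵ⇒x±1-∉-expandᴵ : ∀ {x} I → ¬ x ∈ᴵ I → ¬ x -ℤ + 1 ∈ᴵ expandᴵ I ⊎ ¬ x +ℤ + 1 ∈ᴵ expandᴵ I
∉ᴵ⇒x±1-∉-expandᴵ {x} (a , n) x∉ with a ℤ.≤? x | x ℤ.≤? a +ℤ + n
... | no a≰x | _ = inj₁ (ℤ.<⇒≱ (ℤ.+-monoˡ-< (- + 1) (ℤ.≰⇒> a≰x)) ∘ proj₁)
... | yes _ | no x≰ =
  inj₂ (ℤ.<⇒≱ (subst (_<ℤ x +ℤ + 1) (sym (expandᴵ-top a n)) (ℤ.+-monoˡ-< (+ 1) (ℤ.≰⇒> x≰))) ∘ proj₂)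
... | yes a≤x | yes x≤ = ⊥-elim (x∉ (a≤x , x≤))

Rectangle : Set
Rectangle = Interval × Interval

infix 4 _∈ᴿ_ _∈ᴿ?_

_∈ᴿ_ : Vertex → Rectangle → Set
(x , y) ∈ᴿ (I , J) = x ∈ᴵ I × y ∈ᴵ J

_∈ᴿ?_ : ∀ v R → Dec (v ∈ᴿ R)
(x , y) ∈ᴿ? (I , J) = (x ∈ᴵ? I) ×-dec (y ∈ᴵ? J)

expand : Rectangle → Rectangle
expand (I , J) = (expandᴵ I , expandᴵ J)

∈-expand : ∀ v R → v ∈ᴿ R → v ∈ᴿ expand R
∈-expand (x , y) (I , J) (x∈ , y∈) = ∈-expandᴵ I x∈ , ∈-expandᴵ J y∈

neighbour-∈-expand : ∀ v u R → Adjacent v u → v ∈ᴿ R → u ∈ᴿ expand R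
neighbour-∈-expand (x , y) _ (I , J) (here refl) (x∈ , y∈) = x+1-∈-expandᴵ I x∈ , ∈-expandᴵ J y∈
neighbour-∈-expand (x , y) _ (I , J) (there (here refl)) (x∈ , y∈) = x-1-∈-expandᴵ I x∈ , ∈-expandᴵ J y∈
neighbour-∈-expand (x , y) _ (I , J) (there (there (here refl))) (x∈ , y∈) = ∈-expandᴵ I x∈ , x+1-∈-expandᴵ J y∈
neighbour-∈-expand (x , y) _ (I , J) (there (there (there (here refl)))) (x∈ , y∈) = ∈-expandᴵ I x∈ , x-1-∈-expandᴵ J y∈

closedNbhd-∈⇒∈-expand : ∀ v u R → u ∈ closedNbhd v → u ∈ᴿ R → v ∈ᴿ expand R
closedNbhd-∈⇒∈-expand v _ R (here refl) = ∈-expand v R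
closedNbhd-∈⇒∈-expand v u R (there v~u) = neighbour-∈-expand u v R (adjacent-sym v u v~u)

∉⇒far-neighbour : ∀ v R → ¬ v ∈ᴿ R → ∃[ r ] (r ∈ closedNbhd v × ¬ r ∈ᴿ expand R)
∉⇒far-neighbour (x , y) (I , J) v∉ with x ∈ᴵ? I | y ∈ᴵ? J
... | no x∉ | _ with ∉ᴵ⇒x±1-∉-expandᴵ I x∉
...   | inj₁ x-1∉ = _ , there (there (here refl)) , x-1∉ ∘ proj₁
...   | inj₂ x+1∉ = _ , there (here refl) , x+1∉ ∘ proj₁
∉⇒far-neighbour (x , y) (I , J) v∉ | yes _ | no y∉ with ∉ᴵ⇒x±1-∉-expandᴵ J y∉
...   | inj₁ y-1∉ = _ , there (there (there (there (here refl)))) , y-1∉ ∘ proj₂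
...   | inj₂ y+1∉ = _ , there (there (there (here refl))) , y+1∉ ∘ proj₂
∉⇒far-neighbour (x , y) (I , J) v∉ | yes x∈ | yes y∈ = ⊥-elim (v∉ (x∈ , y∈))

module _ {A : Set} {P : A → Set} (P? : Decidable P) where

  unique-length≤suc-filter : ∀ {w} {xs : List A} → Unique xs → (∀ {x} → x ∈ xs → ¬ P x → x ≡ w) →
                             length xs ℕ.≤ ℕ.suc (length (filter P? xs))
  unique-length≤suc-filter {xs = []} [] _ = ℕ.z≤n
  unique-length≤suc-filter {xs = x ∷ xs} (x∉xs ∷ unique) only with P? x
  ... | yes _ = ℕ.s≤s (unique-length≤suc-filter unique (only ∘ there))
  ... | no ¬px = ℕ.s≤s (ℕ.≤-reflexive (sym (cong length (filter-all P? (All.tabulate P-rest)))))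
    where
    P-rest : ∀ {y} → y ∈ xs → P y
    P-rest {y} y∈xs = decidable-stable (P? y) λ ¬py →
      All.lookup x∉xs y∈xs (trans (only (here refl) ¬px) (sym (only (there y∈xs) ¬py)))

·-nonneg : ∀ {q} n → 0ℚ ≤ℚ q → 0ℚ ≤ℚ n · q
·-nonneg ℕ.zero _ = ℚ.≤-refl
·-nonneg (ℕ.suc n) 0≤q = ℚ.+-mono-≤ 0≤q (·-nonneg n 0≤q)

·-monoˡ-≤ : ∀ {q m n} → 0ℚ ≤ℚ q → m ℕ.≤ n → m · q ≤ℚ n · q
·-monoˡ-≤ 0≤q (ℕ.z≤n {n}) = ·-nonneg n 0≤q
·-monoˡ-≤ {q} 0≤q (ℕ.s≤s m≤n) = ℚ.+-monoʳ-≤ q (·-monoˡ-≤ 0≤q m≤n)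

·-monoʳ-≤ : ∀ {p q} n → p ≤ℚ q → n · p ≤ℚ n · q
·-monoʳ-≤ ℕ.zero _ = ℚ.≤-refl
·-monoʳ-≤ (ℕ.suc n) p≤q = ℚ.+-mono-≤ p≤q (·-monoʳ-≤ n p≤q)

·-monoʳ-< : ∀ {p q} n → p < q → ℕ.suc n · p < ℕ.suc n · q
·-monoʳ-< n p<q = ℚ.+-mono-<-≤ p<q (·-monoʳ-≤ n (ℚ.<⇒≤ p<q))

0ℚ≤1ℚ : 0ℚ ≤ℚ 1ℚ
0ℚ≤1ℚ = *≤* (+≤+ ℕ.z≤n)

cooperators : Config → List Vertex → List Vertex
cooperators C = filter (λ u → C u ≟ᵇ true)

payoff-against-defector : ∀ T a → payoff T a false ≡ 0ℚ
payoff-against-defector T false = refl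
payoff-against-defector T true = refl

payoff-sum≡cooperators·payoff : ∀ T C a us → foldr _+ℚ_ 0ℚ (map (λ u → payoff T a (C u)) us) ≡ length (cooperators C us) · payoff T a true
payoff-sum≡cooperators·payoff T C a [] = refl
payoff-sum≡cooperators·payoff T C a (u ∷ us) with C u
... | true = cong (payoff T a true +ℚ_) (payoff-sum≡cooperators·payoff T C a us)
... | false = begin
  payoff T a false +ℚ rest ≡⟨ cong (_+ℚ rest) (payoff-against-defector T a) ⟩
  0ℚ +ℚ rest               ≡⟨ ℚ.+-identityˡ rest ⟩
  rest                     ≡⟨ payoff-sum≡cooperators·payoff T C a us ⟩
  length (cooperators C us) · payoff T a true ∎
  where
  open ≡-Reasoning
  rest : ℚ
  rest = foldr _+ℚ_ 0ℚ (map (λ u → payoff T a (C u)) us)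

score≡cooperators·payoff : ∀ T C v → score T C v ≡ length (cooperators C (neighbours v)) · payoff T (C v) true
score≡cooperators·payoff T C v = payoff-sum≡cooperators·payoff T C (C v) (neighbours v)

defectorMostSuccessful? : ∀ T C v → Dec (DefectorMostSuccessful T C v)
defectorMostSuccessful? T C v = map′ fromAny toAny
  (any? (λ u → (C u ≟ᵇ false) ×-dec all? (λ x → score T C x ℚ.≤? score T C u) (closedNbhd v)) (closedNbhd v))
  where
  fromAny : Any (λ u → C u ≡ false × All (λ x → score T C x ≤ℚ score T C u) (closedNbhd v)) (closedNbhd v) →
            DefectorMostSuccessful T C v
  fromAny found with find found
  ... | u , u∈ , cu , dominates = u , u∈ , cu , λ x → All.lookup dominates
  toAny : DefectorMostSuccessful T C v →
          Any (λ u → C u ≡ false × All (λ x → score T C x ≤ℚ score T C u) (closedNbhd v)) (closedNbhd v)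
  toAny (u , u∈ , cu , dominates) = lose u∈ (cu , All.tabulate (dominates _))

weak? : ∀ T C v → Dec (Weak T C v)
weak? T C v =
  ((C v ≟ᵇ true) ×-dec defectorMostSuccessful? T C v) ⊎-dec ((C v ≟ᵇ false) ×-dec ¬? (defectorMostSuccessful? T C v))

most-successful-exists : ∀ T C v → ∃[ z ] (z ∈ closedNbhd v × (∀ x → x ∈ closedNbhd v → score T C x ≤ℚ score T C z))
most-successful-exists T C v = z , z∈ (argmax-sel (score T C) v (neighbours v)) , dominates
  where
  z : Vertex
  z = argmax (score T C) v (neighbours v)
  z∈ : z ≡ v ⊎ z ∈ neighbours v → z ∈ closedNbhd v
  z∈ (inj₁ z≡v) = here z≡v
  z∈ (inj₂ z∈ns) = there z∈ns
  dominates : ∀ x → x ∈ closedNbhd v → score T C x ≤ℚ score T C z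
  dominates x (here refl) = f[⊥]≤f[argmax] {f = score T C} v (neighbours v)
  dominates x (there x∈) = All.lookup (f[xs]≤f[argmax] {f = score T C} v (neighbours v)) x∈

DefectorsIn : Rectangle → Config → Set
DefectorsIn R C = ∀ v → C v ≡ false → v ∈ᴿ R

NoIsolatedDefector : Config → Set
NoIsolatedDefector C = ∀ v → C v ≡ false → Any (λ u → C u ≡ false) (neighbours v)

LoneDefectorIn : Rectangle → Config → Set
LoneDefectorIn R C = ∃[ v₀ ] (v₀ ∈ᴿ R × (∀ v → C v ≡ false → v ≡ v₀))

-- A lone defector has no defecting neighbour, so the second alternative is needed; it can only
-- spread to its neighbours, which lie in expand R.
Confined : Rectangle → Config → Set
Confined R C = (DefectorsIn (expand R) C × NoIsolatedDefector C) ⊎ LoneDefectorIn R C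

confined-resp : ∀ R {C C′} → (∀ u → C′ u ≡ C u) → Confined R C → Confined R C′
confined-resp R same (inj₁ (inR , isolated)) =
  inj₁ ((λ u → inR u ∘ trans (sym (same u))) , λ u c′u → Any.map (trans (same _)) (isolated u (trans (sym (same u)) c′u)))
confined-resp R same (inj₂ (v₀ , v₀∈ , lone)) = inj₂ (v₀ , v₀∈ , λ u → lone u ∘ trans (sym (same u)))

confined⇒defectorsIn : ∀ R {C} → Confined R C → DefectorsIn (expand (expand R)) C
confined⇒defectorsIn R (inj₁ (inR , _)) v cv = ∈-expand v (expand R) (inR v cv)
confined⇒defectorsIn R (inj₂ (v₀ , v₀∈ , lone)) v cv =
  subst (_∈ᴿ expand (expand R)) (sym (lone v cv)) (∈-expand v₀ (expand R) (∈-expand v₀ R v₀∈))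

cluster-defector-neighbour : ∀ {C D} → DefectorCluster C D → ∀ {u t} → u ∈ D → t ∈ D → u ≢ t →
                             Any (λ n → C n ≡ false) (neighbours u)
cluster-defector-neighbour (D⇔ , connected) {u} {t} u∈ t∈ u≢t with connected u t u∈ t∈
... | ε = ⊥-elim (u≢t refl)
... | (_ , n∈ , u~n) ◅ _ = lose u~n (Equivalence.from (D⇔ _) n∈)

cluster-confined : ∀ {C D} R → DefectorCluster C D → DefectorsIn R C → Confined R C
cluster-confined {C} {D = []} R (D⇔ , _) _ = inj₁ ((λ v → ⊥-elim ∘ no-defector v) , (λ v → ⊥-elim ∘ no-defector v))
  where
  no-defector : ∀ v → ¬ C v ≡ false
  no-defector v cv with Equivalence.to (D⇔ v) cv
  ... | ()
cluster-confined {C} {D = d ∷ ds} R cluster@(D⇔ , _) inR with any? (λ x → ¬? (x ≟ᵛ d)) (d ∷ ds)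
... | yes other = inj₁ ((λ v → ∈-expand v R ∘ inR v) , nonIsolated)
  where
  nonIsolated : NoIsolatedDefector C
  nonIsolated u cu with find other | u ≟ᵛ d
  ... | e , e∈ , e≢d | yes refl = cluster-defector-neighbour cluster (Equivalence.to (D⇔ u) cu) e∈ (e≢d ∘ sym)
  ... | _ | no u≢d = cluster-defector-neighbour cluster (Equivalence.to (D⇔ u) cu) (here refl) u≢d
... | no none = inj₂ (d , inR d (Equivalence.from (D⇔ d) (here refl)) , λ v cv →
  decidable-stable (v ≟ᵛ d) (λ v≢d → none (lose (Equivalence.to (D⇔ v) cv) v≢d)))

module Dynamics {T : ℚ} (1<T : 1ℚ < T) (T<4/3 : T < + 4 / 3) where

  payoff-nonneg : ∀ a b → 0ℚ ≤ℚ payoff T a b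
  payoff-nonneg false false = ℚ.≤-refl
  payoff-nonneg false true = ℚ.≤-trans 0ℚ≤1ℚ (ℚ.<⇒≤ 1<T)
  payoff-nonneg true false = ℚ.≤-refl
  payoff-nonneg true true = 0ℚ≤1ℚ

  score≤3·payoff : ∀ C v → Any (λ u → C u ≡ false) (neighbours v) → score T C v ≤ℚ 3 · payoff T (C v) true
  score≤3·payoff C v defecting = begin
    score T C v                                        ≡⟨ score≡cooperators·payoff T C v ⟩
    length (cooperators C (neighbours v)) · payoff T (C v) true ≤⟨ ·-monoˡ-≤ (payoff-nonneg (C v) true) k≤3 ⟩
    3 · payoff T (C v) true                            ∎
    where
    open ℚ.≤-Reasoning
    k≤3 : length (cooperators C (neighbours v)) ℕ.≤ 3
    k≤3 = ℕ.≤-pred (subst (length (cooperators C (neighbours v)) ℕ.<_) (length-neighbours v)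
      (filter-notAll (λ u → C u ≟ᵇ true) (neighbours v) (Any.map not-¬ defecting)))

  3·payoff≤score : ∀ C v w → (∀ {u} → u ∈ neighbours v → C u ≡ false → u ≡ w) → 3 · payoff T (C v) true ≤ℚ score T C v
  3·payoff≤score C v w only = begin
    3 · payoff T (C v) true                            ≤⟨ ·-monoˡ-≤ (payoff-nonneg (C v) true) 3≤k ⟩
    length (cooperators C (neighbours v)) · payoff T (C v) true ≡⟨ score≡cooperators·payoff T C v ⟨
    score T C v                                        ∎
    where
    open ℚ.≤-Reasoning
    3≤k : 3 ℕ.≤ length (cooperators C (neighbours v))
    3≤k = ℕ.≤-pred (subst (ℕ._≤ ℕ.suc (length (cooperators C (neighbours v)))) (length-neighbours v)
      (unique-length≤suc-filter (λ u → C u ≟ᵇ true) (neighbours-unique v) (λ u∈ → only u∈ ∘ ¬-not)))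

  surrounded-cooperator-score : ∀ C v → C v ≡ true → All (λ u → C u ≡ true) (neighbours v) → score T C v ≡ 4 · 1ℚ
  surrounded-cooperator-score C v cv cooperating = begin
    score T C v                                                 ≡⟨ score≡cooperators·payoff T C v ⟩
    length (cooperators C (neighbours v)) · payoff T (C v) true ≡⟨ cong₂ _·_ all-cooperate (cong (λ a → payoff T a true) cv) ⟩
    4 · 1ℚ                                                      ∎
    where
    open ≡-Reasoning
    all-cooperate : length (cooperators C (neighbours v)) ≡ 4
    all-cooperate = trans (cong length (filter-all (λ u → C u ≟ᵇ true) cooperating)) (length-neighbours v)

  nonisolated-defector-score : ∀ C v → C v ≡ false → Any (λ u → C u ≡ false) (neighbours v) → score T C v < 4 · 1ℚ
  nonisolated-defector-score C v cv defecting = begin-strict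
    score T C v             ≤⟨ score≤3·payoff C v defecting ⟩
    3 · payoff T (C v) true ≡⟨ cong (λ a → 3 · payoff T a true) cv ⟩
    3 · T                   <⟨ ·-monoʳ-< 2 T<4/3 ⟩
    3 · (+ 4 / 3)           ≡⟨⟩
    4 · 1ℚ                  ∎
    where open ℚ.≤-Reasoning

  nonisolated-cooperator-score : ∀ C v → C v ≡ true → Any (λ u → C u ≡ false) (neighbours v) → score T C v ≤ℚ 3 · 1ℚ
  nonisolated-cooperator-score C v cv defecting =
    subst (λ a → score T C v ≤ℚ 3 · payoff T a true) cv (score≤3·payoff C v defecting)

  almost-isolated-defector-score : ∀ C v w → C v ≡ false → (∀ {u} → u ∈ neighbours v → C u ≡ false → u ≡ w) →
                                   3 · 1ℚ < score T C v
  almost-isolated-defector-score C v w cv only = begin-strict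
    3 · 1ℚ                  <⟨ ·-monoʳ-< 2 1<T ⟩
    3 · T                   ≡⟨ cong (λ a → 3 · payoff T a true) cv ⟨
    3 · payoff T (C v) true ≤⟨ 3·payoff≤score C v w only ⟩
    score T C v             ∎
    where open ℚ.≤-Reasoning

  most-successful-defector⇒∈ : ∀ R C v → DefectorsIn R C → NoIsolatedDefector C → DefectorMostSuccessful T C v → v ∈ᴿ R
  most-successful-defector⇒∈ R C v inR nonIsolated (z , _ , cz , dominates) with v ∈ᴿ? R
  ... | yes v∈R = v∈R
  ... | no v∉R with ∉⇒far-neighbour v R v∉R
  ...   | r , r∈ , r∉ =
    ⊥-elim (ℚ.<-irrefl r-score (ℚ.≤-<-trans (dominates r r∈) (nonisolated-defector-score C z cz (nonIsolated z cz))))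
    where
    cooperates : ∀ {q} → q ∈ closedNbhd r → C q ≡ true
    cooperates {q} q∈ = ¬-not λ cq → r∉ (closedNbhd-∈⇒∈-expand r q R q∈ (inR q cq))
    r-score : score T C r ≡ 4 · 1ℚ
    r-score = surrounded-cooperator-score C r (cooperates (here refl)) (All.tabulate (cooperates ∘ there))

  weak-defector-neighbour-has-other-defector :
    ∀ C v u → C v ≡ false → ¬ DefectorMostSuccessful T C v → Adjacent v u → C u ≡ false →
    Any (λ n → C n ≡ false × n ≢ v) (neighbours u)
  weak-defector-neighbour-has-other-defector C v u cv ¬dms v~u cu with any? (λ n → (C n ≟ᵇ false) ×-dec ¬? (n ≟ᵛ v)) (neighbours u)
  ... | yes other = other
  ... | no none = ⊥-elim (absurd (most-successful-exists T C v))
    where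
    only : ∀ {n} → n ∈ neighbours u → C n ≡ false → n ≡ v
    only {n} n∈ cn = decidable-stable (n ≟ᵛ v) (λ n≢v → none (lose n∈ (cn , n≢v)))
    absurd : ∃[ z ] (z ∈ closedNbhd v × (∀ x → x ∈ closedNbhd v → score T C x ≤ℚ score T C z)) → ⊥
    absurd (z , z∈ , dominates) = ℚ.<-irrefl refl (begin-strict
      3 · 1ℚ      <⟨ almost-isolated-defector-score C u v cu only ⟩
      score T C u ≤⟨ dominates u (there v~u) ⟩
      score T C z ≤⟨ nonisolated-cooperator-score C z cz (lose (adjacent-sym v z v~z) cv) ⟩
      3 · 1ℚ      ∎)
      where
      open ℚ.≤-Reasoning
      cz : C z ≡ true
      cz = ¬-not (λ cz → ¬dms (z , z∈ , cz , dominates))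
      v~z : Adjacent v z
      v~z = closedNbhd-≢⇒adjacent z∈ (defector≢cooperator cv cz ∘ sym)

  module _ {C C′ : Config} {v : Vertex} (agree : ∀ u → u ≢ v → C′ u ≡ C u) where

    defection-confined : ∀ R → C v ≡ true → C′ v ≡ false → DefectorMostSuccessful T C v → Confined R C → Confined R C′
    defection-confined R cv c′v dms@(z , z∈ , cz , _) confined = inj₁ (confined-in confined , nonIsolated confined)
      where
      v~z : Adjacent v z
      v~z = closedNbhd-≢⇒adjacent z∈ (defector≢cooperator cz cv)
      survives : ∀ {u} → C u ≡ false → C′ u ≡ false
      survives {u} cu = trans (agree u (defector≢cooperator cu cv)) cu
      new-or-old : ∀ u → C′ u ≡ false → u ≡ v ⊎ C u ≡ false
      new-or-old u c′u with u ≟ᵛ v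
      ... | yes u≡v = inj₁ u≡v
      ... | no u≢v = inj₂ (trans (sym (agree u u≢v)) c′u)
      confined-in : Confined R C → DefectorsIn (expand R) C′
      confined-in (inj₁ (inR , nonIsolated)) u c′u with new-or-old u c′u
      ... | inj₁ refl = most-successful-defector⇒∈ (expand R) C v inR nonIsolated dms
      ... | inj₂ cu = inR u cu
      confined-in (inj₂ (v₀ , v₀∈ , lone)) u c′u with new-or-old u c′u
      ... | inj₁ refl = neighbour-∈-expand v₀ v R (subst (λ q → Adjacent q v) (lone z cz) (adjacent-sym v z v~z)) v₀∈
      ... | inj₂ cu = subst (_∈ᴿ expand R) (sym (lone u cu)) (∈-expand v₀ R v₀∈)
      nonIsolated : Confined R C → NoIsolatedDefector C′
      nonIsolated confined u c′u with new-or-old u c′u | confined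
      ... | inj₁ refl | _ = lose v~z (survives cz)
      ... | inj₂ cu | inj₁ (_ , nonIsolated) = Any.map survives (nonIsolated u cu)
      ... | inj₂ cu | inj₂ (v₀ , _ , lone) =
        subst (λ q → Any (λ n → C′ n ≡ false) (neighbours q)) (trans (lone z cz) (sym (lone u cu)))
          (lose (adjacent-sym v z v~z) c′v)

    earlier-defector : C′ v ≡ true → ∀ u → C′ u ≡ false → C u ≡ false × u ≢ v
    earlier-defector c′v u c′u = trans (sym (agree u u≢v)) c′u , u≢v
      where
      u≢v : u ≢ v
      u≢v = defector≢cooperator c′u c′v

    cooperation-confined : ∀ R → C v ≡ false → C′ v ≡ true → ¬ DefectorMostSuccessful T C v → Confined R C → Confined R C′
    cooperation-confined R cv c′v ¬dms (inj₁ (inR , nonIsolated)) =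
      inj₁ ((λ u → inR u ∘ proj₁ ∘ earlier-defector c′v u) , nonIsolated′)
      where
      nonIsolated′ : NoIsolatedDefector C′
      nonIsolated′ u c′u with earlier-defector c′v u c′u
      ... | cu , _ with find (nonIsolated u cu)
      ...   | n , n∈ , cn with n ≟ᵛ v
      ...     | no n≢v = lose n∈ (trans (agree n n≢v) cn)
      ...     | yes refl = Any.map (λ (cn′ , n′≢v) → trans (agree _ n′≢v) cn′)
                  (weak-defector-neighbour-has-other-defector C v u cv ¬dms (adjacent-sym u v n∈) cu)
    cooperation-confined R cv c′v ¬dms (inj₂ (v₀ , v₀∈ , lone)) =
      inj₂ (v₀ , v₀∈ , λ u → lone u ∘ proj₁ ∘ earlier-defector c′v u)

  update-confined : ∀ R {C C′ v} → UpdateOne T C v C′ → Confined R C → Confined R C′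
  update-confined R {C} {C′} {v} (agree , flip , keep) with weak? T C v
  ... | yes weak@(inj₁ (cv , dms)) = defection-confined agree R cv (trans (flip weak) (cong not cv)) dms
  ... | yes weak@(inj₂ (cv , ¬dms)) = cooperation-confined agree R cv (trans (flip weak) (cong not cv)) ¬dms
  ... | no ¬weak = confined-resp R unchanged
    where
    unchanged : ∀ u → C′ u ≡ C u
    unchanged u with u ≟ᵛ v
    ... | yes refl = keep ¬weak
    ... | no u≢v = agree u u≢v

  updateSeq-confined : ∀ R {C C′ L} → UpdateSeq T C L C′ → Confined R C → Confined R C′
  updateSeq-confined R (done same) = confined-resp R same
  updateSeq-confined R (next step rest) = updateSeq-confined R rest ∘ update-confined R step

  reachable-confined : ∀ R {C C′} → Reachable T C C′ → Confined R C → Confined R C′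
  reachable-confined R ε confined = confined
  reachable-confined R ((_ , _ , _ , round) ◅ rest) = reachable-confined R rest ∘ updateSeq-confined R round

InRect⇒∈ᴿ : ∀ {x₀ y₀ ℓ w} v → InRect x₀ y₀ ℓ w v → v ∈ᴿ ((x₀ , ℓ) , (y₀ , w))
InRect⇒∈ᴿ (x , y) in-rect = in-rect

∈ᴿ-expand²⇒InRect : ∀ {x₀ y₀ ℓ w} v → v ∈ᴿ expand (expand ((x₀ , ℓ) , (y₀ , w))) →
                    InRect (x₀ -ℤ + 1 -ℤ + 1) (y₀ -ℤ + 1 -ℤ + 1) (ℓ + 4) (w + 4) v
∈ᴿ-expand²⇒InRect {x₀} {y₀} {ℓ} {w} (x , y) =
  subst₂ (λ ℓ′ w′ → InRect (x₀ -ℤ + 1 -ℤ + 1) (y₀ -ℤ + 1 -ℤ + 1) ℓ′ w′ (x , y)) (ℕ.+-comm 4 ℓ) (ℕ.+-comm 4 w)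

corollary3p4 : (T : ℚ) → 1ℚ < T → T < (+ 4) / 3 →
    (C₀ : Config) (D : List Vertex) → DefectorCluster C₀ D →
    (x₀ y₀ : ℤ) (ℓ w : ℕ) → (∀ v → C₀ v ≡ false → InRect x₀ y₀ ℓ w v) →
    ∃[ x₁ ] ∃[ y₁ ] (∀ C → Reachable T C₀ C →
      ∀ v → C v ≡ false → InRect x₁ y₁ (ℓ + 4) (w + 4) v)
corollary3p4 T 1<T T<4/3 C₀ D cluster x₀ y₀ ℓ w inRect =
  x₀ -ℤ + 1 -ℤ + 1 , y₀ -ℤ + 1 -ℤ + 1 , λ C reachable v cv →
    ∈ᴿ-expand²⇒InRect {x₀} {y₀} {ℓ} {w} v (confined⇒defectorsIn R (reachable-confined R reachable initially) v cv)
  where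
  open Dynamics 1<T T<4/3
  R : Rectangle
  R = ((x₀ , ℓ) , (y₀ , w))
  initially : Confined R C₀
  initially = cluster-confined R cluster (λ v → InRect⇒∈ᴿ v ∘ inRect v)
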